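{- Let $G$ be a $k$-adjacency dimensional graph of order $n\ge 2$. Then $\operatorname{adim}_k(G)=n$ if and only if $\mathcal{C}_k(G)=V(G)$.
   Context: All graphs are finite and simple. For a graph $G=(V,E)$, $d_{G,2}(x,y)=\min\{d_G(x,y),2\}$ where $d_G$ is the shortest-path distance ($\infty$ between different components). For distinct $x,y\in V$, $\mathcal{C}_G(x,y)=\{z\in V:\ d_{G,2}(x,z)\neq d_{G,2}(y,z)\}$. A set $S\subseteq V$ is a $k$-adjacency generator if $|S\cap\mathcal{C}_G(x,y)|\ge k$ for all distinct $x,y$; a minimum one is a $k$-adjacency basis, of cardinality $\operatorname{adim}_k(G)$. $G$ is $k$-adjacency dimensional if $k$ is the largest integer for which a $k$-adjacency generator exists. Define $\mathcal{C}_k(G)=\bigcup\{\mathcal{C}_G(x,y):\ x\ne y,\ |\mathcal{C}_G(x,y)|=k\}$. -}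

module Defs where

open import Data.Nat using (ℕ; _≤_)
open import Data.Bool using (Bool; true; false)
open import Data.Fin using (Fin; _≟_)
open import Data.Fin.Subset using (Subset; _∩_; ∣_∣; _∈_; inside; outside)
open import Data.Vec using (tabulate)
open import Data.Product using (Σ; _×_; ∃; ∃-syntax)
open import Relation.Binary.PropositionalEquality using (_≡_; _≢_)
open import Relation.Nullary using (yes; no)
import Data.Nat as ℕ

record Graph (n : ℕ) : Set where
  field
    adj    : Fin n → Fin n → Bool
    sym    : ∀ x y → adj x y ≡ adj y x
    irrefl : ∀ x → adj x x ≡ false

module _ {n : ℕ} (G : Graph n) where
  open Graph G

  -- d_{G,2}(x,y) = min{d_G(x,y), 2}: 0 if x = y, 1 if adjacent, 2 otherwise
  -- (distance ≥ 2, including ∞ between different components).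
  dist2 : Fin n → Fin n → ℕ
  dist2 x y with x ≟ y
  ... | yes _ = 0
  ... | no _ with adj x y
  ...   | true  = 1
  ...   | false = 2

  C : Fin n → Fin n → Subset n
  C x y = tabulate λ z → dec (dist2 x z ℕ.≟ dist2 y z)
    where
    dec : ∀ {a b : ℕ} → Relation.Nullary.Dec (a ≡ b) → Bool
    dec (yes _) = false
    dec (no _)  = true

  IsAdjGenerator : ℕ → Subset n → Set
  IsAdjGenerator k S = ∀ x y → x ≢ y → k ≤ ∣ S ∩ C x y ∣

  IsAdjBasis : ℕ → Subset n → Set
  IsAdjBasis k S = IsAdjGenerator k S × (∀ S′ → IsAdjGenerator k S′ → ∣ S ∣ ≤ ∣ S′ ∣)

  AdimIs : ℕ → ℕ → Set
  AdimIs k m = Σ (Subset n) λ S → IsAdjBasis k S × ∣ S ∣ ≡ m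

  IsKAdjDimensional : ℕ → Set
  IsKAdjDimensional k =
    (∃[ S ] IsAdjGenerator k S) × (∀ k′ → (∃[ S ] IsAdjGenerator k′ S) → k′ ≤ k)

  InCk : ℕ → Fin n → Set
  InCk k z = ∃[ x ] ∃[ y ] (x ≢ y × ∣ C x y ∣ ≡ k × z ∈ C x y)

  CkIsV : ℕ → Set
  CkIsV k = ∀ z → InCk k z

-- Since G admits some k-adjacency generator, every C_G(x,y) has at least k
-- elements, so V itself is a k-adjacency generator and adim_k(G) ≤ n.
-- If z ∈ C_G(x,y) with |C_G(x,y)| = k, every k-adjacency generator must contain
-- all of C_G(x,y), in particular z; hence C_k(G) = V forces every generator to
-- be V. Conversely, if z ∉ C_k(G), then every C_G(x,y) containing z has more than
-- k elements, so V ∖ {z} is still a k-adjacency generator and adim_k(G) < n.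
module Submission where

open import Defs
open import Data.Nat using (ℕ; suc; _≤_; _<_; _∸_; s≤s)
import Data.Nat.Properties as ℕ
open import Data.Bool using (true; false)
open import Data.Fin using (Fin; _≟_) renaming (zero to fzero; suc to fsuc)
open import Data.Fin.Subset
  using (Subset; ⊤; ⊥; ∁; ⁅_⁆; _∩_; _∈_; _∉_; _⊆_; ∣_∣)
open import Data.Fin.Subset.Properties
open import Data.Fin.Properties using (any?)
open import Data.Vec using (_∷_)
open import Data.Product using (_,_; proj₁)
open import Function.Bundles using (_⇔_; mk⇔)
open import Relation.Binary.PropositionalEquality
  using (_≢_; sym; subst; cong)
open import Relation.Nullary using (¬_; Dec; yes; no; contradiction)
open import Relation.Nullary.Decidable using (_×-dec_; ¬?)

private
  variable
    m : ℕ

∣b∷p∣≤1+∣p∣ : ∀ b (p : Subset m) → ∣ b ∷ p ∣ ≤ suc ∣ p ∣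
∣b∷p∣≤1+∣p∣ false p = ℕ.n≤1+n ∣ p ∣
∣b∷p∣≤1+∣p∣ true  p = ℕ.≤-refl

p⊆∁q∩p : {p q : Subset m} → (∀ {x} → x ∈ p → x ∉ q) → p ⊆ ∁ q ∩ p
p⊆∁q∩p p∩q≡∅ x∈p = x∈p∩q⁺ (x∉p⇒x∈∁p (p∩q≡∅ x∈p) , x∈p)

x∉p⇒∣p∣≤∣∁⁅x⁆∩p∣ : {x : Fin m} (p : Subset m) → x ∉ p → ∣ p ∣ ≤ ∣ ∁ ⁅ x ⁆ ∩ p ∣
x∉p⇒∣p∣≤∣∁⁅x⁆∩p∣ {x = x} p x∉p =
  p⊆q⇒∣p∣≤∣q∣ (p⊆∁q∩p λ y∈p y∈⁅x⁆ → x∉p (subst (_∈ p) (x∈⁅y⁆⇒x≡y x y∈⁅x⁆) y∈p))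

∣p∣≤1+∣∁⁅x⁆∩p∣ : (x : Fin m) (p : Subset m) → ∣ p ∣ ≤ suc ∣ ∁ ⁅ x ⁆ ∩ p ∣
∣p∣≤1+∣∁⁅x⁆∩p∣ fzero    (b ∷ p)     =
  ℕ.≤-trans (∣b∷p∣≤1+∣p∣ b p) (s≤s (p⊆q⇒∣p∣≤∣q∣ (p⊆∁q∩p {p = p} {q = ⊥} λ _ → ∉⊥)))
∣p∣≤1+∣∁⁅x⁆∩p∣ (fsuc x) (true ∷ p)  = s≤s (∣p∣≤1+∣∁⁅x⁆∩p∣ x p)
∣p∣≤1+∣∁⁅x⁆∩p∣ (fsuc x) (false ∷ p) = ∣p∣≤1+∣∁⁅x⁆∩p∣ x p

x∉p∧x∈q⇒∣p∩q∣<∣q∣ : {x : Fin m} (p q : Subset m) → x ∉ p → x ∈ q → ∣ p ∩ q ∣ < ∣ q ∣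
x∉p∧x∈q⇒∣p∩q∣<∣q∣ {x = x} p q x∉p x∈q =
  p⊂q⇒∣p∣<∣q∣ (p∩q⊆q p q , x , x∈q , λ x∈p∩q → x∉p (proj₁ (x∈p∩q⁻ p q x∈p∩q)))

∣∁⁅x⁆∣<m : (x : Fin m) → ∣ ∁ ⁅ x ⁆ ∣ < m
∣∁⁅x⁆∣<m {suc m} x = begin-strict
  ∣ ∁ ⁅ x ⁆ ∣          ≡⟨ ∣∁p∣≡n∸∣p∣ ⁅ x ⁆ ⟩
  suc m ∸ ∣ ⁅ x ⁆ ∣    ≡⟨ cong (suc m ∸_) (∣⁅x⁆∣≡1 x) ⟩
  m                    <⟨ ℕ.n<1+n m ⟩
  suc m                ∎
  where open ℕ.≤-Reasoning

module _ {n : ℕ} (G : Graph n) where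

  LowerBoundsC : ℕ → Set
  LowerBoundsC k = ∀ x y → x ≢ y → k ≤ ∣ C G x y ∣

  isAdjGenerator⇒lowerBoundsC : ∀ {k S} → IsAdjGenerator G k S → LowerBoundsC k
  isAdjGenerator⇒lowerBoundsC {S = S} gen x y x≢y =
    ℕ.≤-trans (gen x y x≢y) (∣p∩q∣≤∣q∣ S (C G x y))

  ⊤-isAdjGenerator : ∀ {k} → LowerBoundsC k → IsAdjGenerator G k ⊤
  ⊤-isAdjGenerator k≤∣C∣ x y x≢y =
    subst (_ ≤_) (cong ∣_∣ (sym (∩-identityˡ (C G x y)))) (k≤∣C∣ x y x≢y)

  ∁⁅z⁆-isAdjGenerator : ∀ {k z} → LowerBoundsC k → ¬ InCk G k z → IsAdjGenerator G k (∁ ⁅ z ⁆)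
  ∁⁅z⁆-isAdjGenerator {k} {z} k≤∣C∣ z∉Ck x y x≢y with z ∈? C G x y
  ... | no z∉C = ℕ.≤-trans (k≤∣C∣ x y x≢y) (x∉p⇒∣p∣≤∣∁⁅x⁆∩p∣ (C G x y) z∉C)
  ... | yes z∈C = ℕ.≤-pred (ℕ.≤-trans k<∣C∣ (∣p∣≤1+∣∁⁅x⁆∩p∣ z (C G x y)))
    where
    k<∣C∣ : k < ∣ C G x y ∣
    k<∣C∣ = ℕ.≤∧≢⇒< (k≤∣C∣ x y x≢y) λ k≡∣C∣ → z∉Ck (x , y , x≢y , sym k≡∣C∣ , z∈C)

  CkIsV⇒⊤⊆adjGenerator : ∀ {k S} → CkIsV G k → IsAdjGenerator G k S → ⊤ ⊆ S
  CkIsV⇒⊤⊆adjGenerator {k} {S} Ck≡V gen {z} _ with z ∈? S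
  ... | yes z∈S = z∈S
  ... | no z∉S with Ck≡V z
  ...   | x , y , x≢y , ∣C∣≡k , z∈C = contradiction (gen x y x≢y) (ℕ.<⇒≱ ∣S∩C∣<k)
    where
    ∣S∩C∣<k : ∣ S ∩ C G x y ∣ < k
    ∣S∩C∣<k = subst (_ <_) ∣C∣≡k (x∉p∧x∈q⇒∣p∩q∣<∣q∣ S (C G x y) z∉S z∈C)

  InCk? : ∀ k z → Dec (InCk G k z)
  InCk? k z = any? λ x → any? λ y →
    ¬? (x ≟ y) ×-dec (∣ C G x y ∣ ℕ.≟ k) ×-dec (z ∈? C G x y)

theorem13 : (n k : ℕ) (G : Graph n) → 2 ≤ n → IsKAdjDimensional G k →
    (AdimIs G k n ⇔ CkIsV G k)
theorem13 n k G _ ((S₀ , gen) , _) = mk⇔ adim≡n⇒CkIsV CkIsV⇒adim≡n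
  where
  k≤∣C∣ : LowerBoundsC G k
  k≤∣C∣ = isAdjGenerator⇒lowerBoundsC G {k} {S₀} gen

  CkIsV⇒adim≡n : CkIsV G k → AdimIs G k n
  CkIsV⇒adim≡n Ck≡V =
    ⊤ , (⊤-isAdjGenerator G k≤∣C∣ , ⊤-minimal) , ∣⊤∣≡n n
    where
    ⊤-minimal : ∀ S → IsAdjGenerator G k S → ∣ ⊤ {n} ∣ ≤ ∣ S ∣
    ⊤-minimal S gen′ = p⊆q⇒∣p∣≤∣q∣ (CkIsV⇒⊤⊆adjGenerator G {k} {S} Ck≡V gen′)

  adim≡n⇒CkIsV : AdimIs G k n → CkIsV G k
  adim≡n⇒CkIsV (S , (_ , minimal) , ∣S∣≡n) z with InCk? G k z
  ... | yes z∈Ck = z∈Ck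
  ... | no z∉Ck = contradiction (minimal (∁ ⁅ z ⁆) (∁⁅z⁆-isAdjGenerator G {k} k≤∣C∣ z∉Ck))
                    (ℕ.<⇒≱ (subst (_ <_) (sym ∣S∣≡n) (∣∁⁅x⁆∣<m z)))
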